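{- For every integer $n\ge 2$, let $G_n$ be the graph obtained from the one-way infinite path $P_{1\infty}$ with vertices $v_0,v_1,v_2,\dots$ (edges $v_iv_{i+1}$) by attaching, for each $i\ge 0$, a copy of the complete $i$-level $n$-ary tree $T(n,i)$ whose root is identified with $v_i$. Then $\chi_L(G_n)=\infty$.
   Context: The complete $i$-level $n$-ary tree $T(n,i)$ is the rooted tree in which every vertex at depth less than $i$ has exactly $n$ children and all leaves are at depth $i$ (so it has $n^i$ leaves; $T(n,0)$ is a single vertex); its root is called its center. For a simple graph $G$ and integer $k\ge1$, a $k$-coloring is a map $c:V(G)\to\{1,\dots,k\}$ with adjacent vertices receiving different colors. With color classes $X_1,\dots,X_k$, the color code of $v$ is $(d(v,X_1),\dots,d(v,X_k))$, where $d(v,X_i)=\min_{x\in X_i}d(v,x)$. A locating $k$-coloring is a $k$-coloring in which all vertices have distinct color codes; $\chi_L(G)$ is the least such $k$, and $\chi_L(G)=\infty$ if none exists. -}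

module Defs where

open import Data.Nat using (ℕ; zero; suc; _≤_; _<_)
open import Data.Fin using (Fin)
open import Data.List using (List; []; _∷_; length)
open import Data.Product using (Σ; _×_; _,_; ∃; ∃-syntax)
open import Data.Sum using (_⊎_)
open import Relation.Binary.PropositionalEquality using (_≡_; _≢_)
open import Relation.Nullary using (¬_)
open import Function.Bundles using (_⇔_)

-- A vertex is (i , w , p): it lies in the copy of T(n,i) hanging at the
-- spine vertex v_i, and w (a word over Fin n, of length ≤ i) is its
-- address in that tree.  The root (i , [] , _) is the spine vertex v_i.

V : ℕ → Set
V n = Σ ℕ λ i → Σ (List (Fin n)) λ w → length w ≤ i

data Step (n : ℕ) : V n → V n → Set where
  spine : ∀ {i} (p : 0 ≤ i) (q : 0 ≤ suc i) →
          Step n (i , [] , p) (suc i , [] , q)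
  child : ∀ {i} (w : List (Fin n)) (a : Fin n)
          (p : length w ≤ i) (q : length (a ∷ w) ≤ i) →
          Step n (i , w , p) (i , a ∷ w , q)

Adj : (n : ℕ) → V n → V n → Set
Adj n u v = Step n u v ⊎ Step n v u

data Walk (n : ℕ) : V n → V n → ℕ → Set where
  nil  : ∀ {u} → Walk n u u 0
  cons : ∀ {u v x m} → Adj n u v → Walk n v x m → Walk n u x (suc m)

Dist : (n : ℕ) → V n → V n → ℕ → Set
Dist n u v d = Walk n u v d × (∀ m → Walk n u v m → d ≤ m)

IsColoring : (n k : ℕ) → (V n → Fin k) → Set
IsColoring n k c = ∀ u v → Adj n u v → c u ≢ c v

-- DistClass n k c u j d : d(u , X_j) = d, where X_j = c⁻¹(j)
-- (no such d exists iff X_j is empty, i.e. d(u , X_j) = ∞)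
DistClass : (n k : ℕ) → (V n → Fin k) → V n → Fin k → ℕ → Set
DistClass n k c u j d =
  (∃[ x ] (c x ≡ j × Dist n u x d)) ×
  (∀ x → c x ≡ j → ∀ d' → Dist n u x d' → d ≤ d')

SameCode : (n k : ℕ) → (V n → Fin k) → V n → V n → Set
SameCode n k c u v = ∀ j d → DistClass n k c u j d ⇔ DistClass n k c v j d

IsLocatingColoring : (n k : ℕ) → (V n → Fin k) → Set
IsLocatingColoring n k c =
  IsColoring n k c × (∀ u v → u ≢ v → ¬ SameCode n k c u v)

ChiLInfinite : ℕ → Set
ChiLInfinite n = ∀ k → 1 ≤ k → (c : V n → Fin k) → ¬ IsLocatingColoring n k c

-- Let w be a leaf of the copy of T(n,I) hanging at v_I. A vertex of G_n outside that copy,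
-- at depth l below v_i, lies at distance I + |I - i| + l from w, whatever w is. Hence the
-- colour code of w is determined by its profile: for each colour, the distance from w to
-- the nearest vertex of that colour inside the copy, a number in {0, ..., 2I}, or "none".
-- There are at most (2I + 2)^k profiles but n^I ≥ 2^I leaves, so for I large two leaves
-- share a profile and therefore a colour code.

module Submission where

open import Defs
open import Data.Nat using (ℕ; zero; suc; _+_; _*_; _∸_; _^_; _≤_; _<_; z≤n; s≤s; s≤s⁻¹; ∣_-_∣; _≟_; _≤?_)
open import Data.Nat.Properties
  using (≤-refl; ≤-trans; ≤-reflexive; ≤-antisym; ≤-irrelevant; ≤-total; <⇒≤; ≰⇒>; ≤-<-trans; n≤1+n;
         +-suc; +-identityʳ; +-monoˡ-≤; +-monoʳ-≤; +-∸-assoc; m∸n≤m; m≤m+n; m∸n+n≡m;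
         +-mono-≤; n<1+n; m≤n⇒m≤1+n; n∸n≡0; ∣-∣-comm; ∣-∣-identityʳ; ∣n-n∣≡0; m≤n⇒∣m-n∣≡n∸m;
         *-monoˡ-<; *-mono-≤; m^n>0; ^-monoˡ-≤; ^-monoʳ-<; ^-*-assoc; ^-distribˡ-+-*; module ≤-Reasoning)
open import Data.Fin using (Fin; fromℕ<; funToFin; finToFun; combine)
open import Data.Fin.Properties using (any?; pigeonhole; fromℕ<-injective; funToFin-finToFin; finToFun-funToFin; <⇒≢)
  renaming (_≟_ to _≟ᶠ_)
open import Data.List using (List; []; _∷_; length; drop; tabulate)
open import Data.List.Properties using (≡-dec; drop-all; ∷-injective; length-tabulate)
open import Data.Product using (Σ; _×_; _,_; ∃; ∃-syntax; proj₁; proj₂)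
open import Data.Sum using (inj₁; inj₂; swap)
open import Function using (_∘_)
open import Function.Bundles using (_⇔_; mk⇔; Equivalence)
open import Function.Properties.Equivalence using (⇔-isEquivalence)
open import Level using (0ℓ)
open import Relation.Binary.PropositionalEquality
  using (_≡_; _≢_; _≗_; refl; sym; trans; cong; cong₂; subst; subst₂)
open import Relation.Binary.Structures using (IsEquivalence)
open import Relation.Nullary using (Dec; yes; no; contradiction)
open import Relation.Nullary.Decidable using (_×-dec_)
open import Relation.Unary using (Decidable)
open import Data.Nat.Tactic.RingSolver using (solve-∀)

private
  module ⇔ = IsEquivalence (⇔-isEquivalence {ℓ = 0ℓ})

  variable
    n k m m' d e i : ℕ
    u v x : V n

_∷ʳ_ : Walk n u v m → Adj n v x → Walk n u x (suc m)
nil ∷ʳ a = cons a nil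
cons a r ∷ʳ b = cons a (r ∷ʳ b)

_++ʷ_ : Walk n u v m → Walk n v x m' → Walk n u x (m + m')
nil ++ʷ s = s
cons a r ++ʷ s = cons a (r ++ʷ s)

reverse : Walk n u v m → Walk n v u m
reverse nil = nil
reverse (cons a r) = reverse r ∷ʳ swap a

Lipschitz : (V n → ℕ) → Set
Lipschitz {n} δ = ∀ {y z} → Adj n y z → δ z ≤ suc (δ y)

walk-length-bound : (δ : V n → ℕ) → Lipschitz δ → Walk n u v m → δ v ≤ δ u + m
walk-length-bound {u = u} δ lip nil = ≤-reflexive (sym (+-identityʳ (δ u)))
walk-length-bound {u = u} {v = v} δ lip (cons {v = y} {m = m} a r) = begin
  δ v           ≤⟨ walk-length-bound δ lip r ⟩
  δ y + m       ≤⟨ +-monoˡ-≤ m (lip a) ⟩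
  suc (δ u) + m ≡⟨ sym (+-suc (δ u) m) ⟩
  δ u + suc m   ∎
  where open ≤-Reasoning

dist-unique : Dist n u v d → Dist n u v e → d ≡ e
dist-unique (p , shortest-p) (q , shortest-q) = ≤-antisym (shortest-p _ q) (shortest-q _ p)

dist-from-potential : (δ : V n → ℕ) → δ u ≡ 0 → Lipschitz δ → (∀ v → Walk n u v (δ v)) →
                      ∀ v → Dist n u v (δ v)
dist-from-potential δ δu≡0 lip walk v =
  walk v , λ m p → subst (λ z → δ v ≤ z + m) δu≡0 (walk-length-bound δ lip p)

Least : (ℕ → Set) → ℕ → Set
Least P d = P d × (∀ e → P e → d ≤ e)

least-⇔ : {P Q : ℕ → Set} → (∀ e → P e ⇔ Q e) → Least P d ⇔ Least Q d
least-⇔ P⇔Q = mk⇔ (transport P⇔Q) (transport (⇔.sym ∘ P⇔Q))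
  where
  transport : {P Q : ℕ → Set} → (∀ e → P e ⇔ Q e) → Least P d → Least Q d
  transport P⇔Q (pd , minimal) = Equivalence.to (P⇔Q _) pd , λ e qe → minimal e (Equivalence.from (P⇔Q e) qe)

Near : (V n → Fin k) → (V n → ℕ) → Fin k → ℕ → Set
Near c δ j e = ∃ λ x → c x ≡ j × δ x ≤ e

distClass⇔least : (c : V n → Fin k) (δ : V n → ℕ) → (∀ v → Dist n u v (δ v)) →
                  ∀ j d → DistClass n k c u j d ⇔ Least (Near c δ j) d
distClass⇔least c δ dist j d = mk⇔ to from
  where
  to : DistClass _ _ c _ j d → Least (Near c δ j) d
  to ((x , cx , dx) , shortest) =
    (x , cx , ≤-reflexive (dist-unique (dist x) dx)) ,
    λ e (y , cy , δy≤e) → ≤-trans (shortest y cy (δ y) (dist y)) δy≤e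
  from : Least (Near c δ j) d → DistClass _ _ c _ j d
  from ((x , cx , δx≤d) , minimal) =
    (x , cx , subst (Dist _ _ x) (≤-antisym δx≤d (minimal (δ x) (x , cx , ≤-refl))) (dist x)) ,
    λ y cy d' dy → minimal d' (y , cy , ≤-reflexive (dist-unique (dist y) dy))

sameCode-of-near : (c : V n → Fin k) (δ δ' : V n → ℕ) →
                   (∀ y → Dist n u y (δ y)) → (∀ y → Dist n v y (δ' y)) →
                   (∀ j e → Near c δ j e ⇔ Near c δ' j e) → SameCode n k c u v
sameCode-of-near c δ δ' dist dist' near⇔ j d =
  ⇔.trans (distClass⇔least c δ dist j d)
    (⇔.trans (least-⇔ (near⇔ j)) (⇔.sym (distClass⇔least c δ' dist' j d)))

-- The least d < b with P d, or b if there is none.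
least : {P : ℕ → Set} → Decidable P → ℕ → ℕ
least P? zero = zero
least P? (suc b) with P? 0
... | yes _ = 0
... | no _ = suc (least (P? ∘ suc) b)

least≤ : {P : ℕ → Set} (P? : Decidable P) (b : ℕ) → least P? b ≤ b
least≤ P? zero = z≤n
least≤ P? (suc b) with P? 0
... | yes _ = z≤n
... | no _ = s≤s (least≤ (P? ∘ suc) b)

least-witness : {P : ℕ → Set} (P? : Decidable P) (b : ℕ) → least P? b < b → P (least P? b)
least-witness P? (suc b) lt with P? 0
... | yes p0 = p0
... | no _ = least-witness (P? ∘ suc) b (s≤s⁻¹ lt)

least-minimal : {P : ℕ → Set} (P? : Decidable P) (b : ℕ) → d < b → P d → least P? b ≤ d
least-minimal P? (suc b) lt pd with P? 0
least-minimal P? (suc b) lt pd | yes _ = z≤n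
least-minimal {zero} P? (suc b) lt pd | no ¬p0 = contradiction pd ¬p0
least-minimal {suc d} P? (suc b) (s≤s lt) pd | no _ = s≤s (least-minimal (P? ∘ suc) b lt pd)

least-characterises : {P : ℕ → Set} (P? : Decidable P) → (∀ {d e} → d ≤ e → P d → P e) →
                      ∀ {s b} → s < b → (∀ {d} → P d → P s) →
                      ∀ d → P d ⇔ (least P? b ≤ d × least P? b < b)
least-characterises {P} P? mono {s} {b} s<b saturate d = mk⇔ to from
  where
  to : P d → least P? b ≤ d × least P? b < b
  to pd with d ≤? s
  ... | yes d≤s = let d<b = ≤-<-trans d≤s s<b
                      ℓ≤d = least-minimal P? b d<b pd
                  in ℓ≤d , ≤-<-trans ℓ≤d d<b
  ... | no d≰s = let ℓ≤s = least-minimal P? b s<b (saturate pd)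
                 in ≤-trans ℓ≤s (<⇒≤ (≰⇒> d≰s)) , ≤-<-trans ℓ≤s s<b
  from : least P? b ≤ d × least P? b < b → P d
  from (ℓ≤d , ℓ<b) = mono ℓ≤d (least-witness P? b ℓ<b)

root : ℕ → V n
root i = i , [] , z≤n

vertex-≡ : {y z : List (Fin n)} {p : length y ≤ i} {q : length z ≤ i} → y ≡ z →
           _≡_ {A = V n} (i , y , p) (i , z , q)
vertex-≡ {p = p} {q} refl = cong (λ r → _ , _ , r) (≤-irrelevant p q)

spine-up : ∀ a t → Walk n (root a) (root (t + a)) t
spine-up a zero = nil
spine-up a (suc t) = spine-up a t ∷ʳ inj₁ (spine z≤n z≤n)

spine-walk≤ : ∀ {a b} → a ≤ b → Walk n (root a) (root b) ∣ a - b ∣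
spine-walk≤ {a = a} {b} a≤b =
  subst₂ (λ z t → Walk _ (root a) (root z) t) (m∸n+n≡m a≤b) (sym (m≤n⇒∣m-n∣≡n∸m a≤b))
    (spine-up a (b ∸ a))

spine-walk : ∀ a b → Walk n (root a) (root b) ∣ a - b ∣
spine-walk a b with ≤-total a b
... | inj₁ a≤b = spine-walk≤ a≤b
... | inj₂ b≤a = subst (Walk _ (root a) (root b)) (∣-∣-comm b a) (reverse (spine-walk≤ b≤a))

descend : ∀ i (y : List (Fin n)) (p : length y ≤ i) → Walk n (root i) (i , y , p) (length y)
descend i [] z≤n = nil
descend i (b ∷ y) p = descend i y (<⇒≤ p) ∷ʳ inj₁ (child y b (<⇒≤ p) p)

ascend : ∀ t (y : List (Fin n)) {z} (p : length y ≤ i) (q : length z ≤ i) →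
         t ≤ length y → drop t y ≡ z → Walk n (i , y , p) (i , z , q) t
ascend zero y p q _ y≡z = subst (λ z → Walk _ (_ , y , p) z 0) (vertex-≡ y≡z) nil
ascend (suc t) (b ∷ y) p q (s≤s t≤) e =
  cons (inj₂ (child y b (<⇒≤ p) p)) (ascend t y (<⇒≤ p) q t≤ e)

drop-suc : ∀ {A : Set} t (y : List A) {b z} → drop t y ≡ b ∷ z → drop (suc t) y ≡ z
drop-suc zero (a ∷ y) refl = refl
drop-suc (suc t) (a ∷ y) e = drop-suc t y e

∣m-1+n∣≤1+∣m-n∣ : ∀ m n → ∣ m - suc n ∣ ≤ suc ∣ m - n ∣
∣m-1+n∣≤1+∣m-n∣ zero n = ≤-refl
∣m-1+n∣≤1+∣m-n∣ (suc m) zero = m≤n⇒m≤1+n (≤-trans (≤-reflexive (∣-∣-identityʳ m)) (n≤1+n m))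
∣m-1+n∣≤1+∣m-n∣ (suc m) (suc n) = ∣m-1+n∣≤1+∣m-n∣ m n

∣m-n∣≤1+∣m-1+n∣ : ∀ m n → ∣ m - n ∣ ≤ suc ∣ m - suc n ∣
∣m-n∣≤1+∣m-1+n∣ zero n = m≤n⇒m≤1+n (n≤1+n n)
∣m-n∣≤1+∣m-1+n∣ (suc m) zero = s≤s (≤-reflexive (sym (∣-∣-identityʳ m)))
∣m-n∣≤1+∣m-1+n∣ (suc m) (suc n) = ∣m-n∣≤1+∣m-1+n∣ m n

+-monoʳ-≤-suc : ∀ a {b c} → b ≤ suc c → a + b ≤ suc (a + c)
+-monoʳ-≤-suc a {b} {c} b≤1+c = subst (a + b ≤_) (+-suc a c) (+-monoʳ-≤ a b≤1+c)

module LeafDistances {n : ℕ} (I : ℕ) (w : List (Fin n)) (|w|≡I : length w ≡ I) where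

  |w|≤I : length w ≤ I
  |w|≤I = ≤-reflexive |w|≡I

  leaf : V n
  leaf = I , w , |w|≤I

  IsAncestor : List (Fin n) → Set
  IsAncestor y = drop (I ∸ length y) w ≡ y

  ancestor? : Decidable IsAncestor
  ancestor? y = ≡-dec _≟ᶠ_ (drop (I ∸ length y) w) y

  -- From y, climb towards the root until the path from w to the root is met.
  treeDist : List (Fin n) → ℕ
  treeDist [] = I
  treeDist (b ∷ y) with ancestor? (b ∷ y)
  ... | yes _ = I ∸ length (b ∷ y)
  ... | no _ = suc (treeDist y)

  -- Outside its own tree the leaf first climbs to v_I and then follows the spine.
  δ : V n → ℕ
  δ (i , y , _) with i ≟ I
  ... | yes _ = treeDist y
  ... | no _ = I + ∣ I - i ∣ + length y

  treeDist-ancestor : ∀ y → IsAncestor y → treeDist y ≡ I ∸ length y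
  treeDist-ancestor [] _ = refl
  treeDist-ancestor (b ∷ y) anc with ancestor? (b ∷ y)
  ... | yes _ = refl
  ... | no ¬anc = contradiction anc ¬anc

  ∸-pred : ∀ {l} → suc l ≤ I → I ∸ l ≡ suc (I ∸ suc l)
  ∸-pred = +-∸-assoc 1

  ancestor-tail : ∀ {b} y → length (b ∷ y) ≤ I → IsAncestor (b ∷ y) → IsAncestor y
  ancestor-tail y p anc rewrite ∸-pred p = drop-suc _ w anc

  treeDist-child : ∀ b y → length (b ∷ y) ≤ I →
                   treeDist (b ∷ y) ≤ suc (treeDist y) × treeDist y ≤ suc (treeDist (b ∷ y))
  treeDist-child b y p with ancestor? (b ∷ y)
  ... | yes anc rewrite treeDist-ancestor y (ancestor-tail y p anc) | ∸-pred p =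
    m≤n⇒m≤1+n (n≤1+n _) , ≤-refl
  ... | no _ = ≤-refl , m≤n⇒m≤1+n (n≤1+n _)

  treeDist≤ : ∀ y → treeDist y ≤ I + length y
  treeDist≤ [] = ≤-reflexive (sym (+-identityʳ I))
  treeDist≤ (b ∷ y) with ancestor? (b ∷ y)
  ... | yes _ = ≤-trans (m∸n≤m I (suc (length y))) (m≤m+n I _)
  ... | no _ = ≤-trans (s≤s (treeDist≤ y)) (≤-reflexive (sym (+-suc I (length y))))

  δ-root : ∀ i → δ (root i) ≡ I + ∣ I - i ∣
  δ-root i with i ≟ I
  ... | yes refl rewrite ∣n-n∣≡0 I = sym (+-identityʳ I)
  ... | no _ = +-identityʳ _

  δ-step : ∀ {y z} → Step n y z → δ z ≤ suc (δ y) × δ y ≤ suc (δ z)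
  δ-step (spine {i} z≤n z≤n) rewrite δ-root i | δ-root (suc i) =
    +-monoʳ-≤-suc I (∣m-1+n∣≤1+∣m-n∣ I i) , +-monoʳ-≤-suc I (∣m-n∣≤1+∣m-1+n∣ I i)
  δ-step (child {i} y b p q) with i ≟ I
  ... | yes refl = treeDist-child b y q
  ... | no _ = ≤-reflexive (+-suc (I + ∣ I - i ∣) (length y)) ,
               m≤n⇒m≤1+n (+-monoʳ-≤ (I + ∣ I - i ∣) (n≤1+n (length y)))

  δ-adj : Lipschitz δ
  δ-adj (inj₁ s) = proj₁ (δ-step s)
  δ-adj (inj₂ s) = proj₂ (δ-step s)

  δ-inside : ∀ y (p : length y ≤ I) → δ (I , y , p) ≡ treeDist y
  δ-inside y p with I ≟ I
  ... | yes _ = refl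
  ... | no I≢I = contradiction refl I≢I

  δ-outside : ∀ {i} y (p : length y ≤ i) → i ≢ I → δ (i , y , p) ≡ I + ∣ I - i ∣ + length y
  δ-outside {i} y p i≢I with i ≟ I
  ... | yes i≡I = contradiction i≡I i≢I
  ... | no _ = refl

  δ-leaf : δ leaf ≡ 0
  δ-leaf = trans (δ-inside w |w|≤I) (trans (treeDist-ancestor w w-ancestor) I∸|w|≡0)
    where
    I∸|w|≡0 : I ∸ length w ≡ 0
    I∸|w|≡0 rewrite |w|≡I = n∸n≡0 I
    w-ancestor : IsAncestor w
    w-ancestor rewrite I∸|w|≡0 = refl

  to-root : Walk n leaf (root I) I
  to-root = ascend I w |w|≤I z≤n (≤-reflexive (sym |w|≡I)) (drop-all I w |w|≤I)

  treeDist-walk : ∀ y (p : length y ≤ I) → Walk n leaf (I , y , p) (treeDist y)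
  treeDist-walk [] z≤n = to-root
  treeDist-walk (b ∷ y) p with ancestor? (b ∷ y)
  ... | yes anc = ascend (I ∸ length (b ∷ y)) w |w|≤I p I∸l≤|w| anc
    where
    I∸l≤|w| : I ∸ length (b ∷ y) ≤ length w
    I∸l≤|w| = subst (I ∸ length (b ∷ y) ≤_) (sym |w|≡I) (m∸n≤m I (length (b ∷ y)))
  ... | no _ = treeDist-walk y (<⇒≤ p) ∷ʳ inj₁ (child y b (<⇒≤ p) p)

  δ-walk : ∀ y → Walk n leaf y (δ y)
  δ-walk (i , y , p) with i ≟ I
  ... | yes refl = treeDist-walk y p
  ... | no _ = (to-root ++ʷ spine-walk I i) ++ʷ descend i y p

  leaf-dist : ∀ y → Dist n leaf y (δ y)
  leaf-dist = dist-from-potential δ δ-leaf δ-adj δ-walk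

∃-short-word? : ∀ {n} m {P : (y : List (Fin n)) → length y ≤ m → Set} → (∀ y p → Dec (P y p)) →
                Dec (∃[ y ] Σ (length y ≤ m) (P y))
∃-short-word? zero P? with P? [] z≤n
... | yes p = yes ([] , z≤n , p)
... | no ¬p = no λ { ([] , z≤n , p) → ¬p p }
∃-short-word? (suc m) P? with P? [] z≤n | ∃-short-word? m (λ y p → any? λ a → P? (a ∷ y) (s≤s p))
... | yes p | _ = yes ([] , z≤n , p)
... | no _ | yes (y , p , a , pa) = yes (a ∷ y , s≤s p , pa)
... | no ¬p | no ¬q = no λ { ([] , z≤n , p) → ¬p p ; (a ∷ y , s≤s p , pa) → ¬q (y , p , a , pa) }

module LeafCode {n k : ℕ} (c : V n → Fin k) (I : ℕ) (w : List (Fin n)) (|w|≡I : length w ≡ I) where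
  open LeafDistances I w |w|≡I public

  InTree : Fin k → ℕ → Set
  InTree j e = ∃[ y ] Σ (length y ≤ I) λ p → c (I , y , p) ≡ j × treeDist y ≤ e

  inTree? : ∀ j → Decidable (InTree j)
  inTree? j e = ∃-short-word? I λ y p → (c (I , y , p) ≟ᶠ j) ×-dec (treeDist y ≤? e)

  inTree-mono : ∀ {j d e} → d ≤ e → InTree j d → InTree j e
  inTree-mono d≤e (y , p , cy , le) = y , p , cy , ≤-trans le d≤e

  inTree-saturate : ∀ {j e} → InTree j e → InTree j (I + I)
  inTree-saturate (y , p , cy , _) = y , p , cy , ≤-trans (treeDist≤ y) (+-monoʳ-≤ I p)

  -- The value 2I + 1 records that colour j does not occur in the tree.
  nearest : Fin k → ℕ
  nearest j = least (inTree? j) (suc (I + I))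

  profile : Fin k → Fin (suc (suc (I + I)))
  profile j = fromℕ< (s≤s (least≤ (inTree? j) (suc (I + I))))

  inTree⇔ : ∀ j e → InTree j e ⇔ (nearest j ≤ e × nearest j < suc (I + I))
  inTree⇔ j = least-characterises (inTree? j) inTree-mono ≤-refl inTree-saturate

-- Two leaves of T(n,I) see the same distances outside the tree, so only what they see
-- inside it can tell them apart.
module TwoLeaves {n k : ℕ} (c : V n → Fin k) (I : ℕ)
                 (w₁ : List (Fin n)) (|w₁|≡I : length w₁ ≡ I)
                 (w₂ : List (Fin n)) (|w₂|≡I : length w₂ ≡ I) where
  module L₁ = LeafCode c I w₁ |w₁|≡I
  module L₂ = LeafCode c I w₂ |w₂|≡I

  inTree-transfer : L₁.profile ≗ L₂.profile → ∀ {j e} → L₁.InTree j e → L₂.InTree j e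
  inTree-transfer same {j} {e} t =
    Equivalence.from (L₂.inTree⇔ j e)
      (subst (λ ℓ → ℓ ≤ e × ℓ < suc (I + I)) (fromℕ<-injective _ _ _ _ (same j))
        (Equivalence.to (L₁.inTree⇔ j e) t))

  near-transfer : L₁.profile ≗ L₂.profile → ∀ {j e} → Near c L₁.δ j e → Near c L₂.δ j e
  near-transfer same {e = e} ((i , y , p) , cy , le) with i ≟ I
  ... | no i≢I = (i , y , p) , cy , subst (_≤ e) (sym (L₂.δ-outside y p i≢I)) le
  ... | yes refl with inTree-transfer same (y , p , cy , le)
  ...   | (y' , p' , cy' , le') = (I , y' , p') , cy' , subst (_≤ e) (sym (L₂.δ-inside y' p')) le'

sameCode-of-profile : {c : V n → Fin k} {I : ℕ} (w₁ : List (Fin n)) (|w₁|≡I : length w₁ ≡ I)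
                      (w₂ : List (Fin n)) (|w₂|≡I : length w₂ ≡ I) →
                      LeafCode.profile c I w₁ |w₁|≡I ≗ LeafCode.profile c I w₂ |w₂|≡I →
                      SameCode n k c (LeafCode.leaf c I w₁ |w₁|≡I) (LeafCode.leaf c I w₂ |w₂|≡I)
sameCode-of-profile {c = c} {I} w₁ |w₁|≡I w₂ |w₂|≡I same =
  sameCode-of-near c _ _ (LeafCode.leaf-dist c I w₁ |w₁|≡I) (LeafCode.leaf-dist c I w₂ |w₂|≡I) λ j e →
    mk⇔ (TwoLeaves.near-transfer c I w₁ |w₁|≡I w₂ |w₂|≡I same)
        (TwoLeaves.near-transfer c I w₂ |w₂|≡I w₁ |w₁|≡I (sym ∘ same))

tabulate-injective : {A : Set} {f g : Fin m → A} → tabulate f ≡ tabulate g → f ≗ g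
tabulate-injective {m = suc m} e Fin.zero = proj₁ (∷-injective e)
tabulate-injective {m = suc m} e (Fin.suc t) = tabulate-injective (proj₂ (∷-injective e)) t

funToFin-cong : {f g : Fin m → Fin n} → f ≗ g → funToFin f ≡ funToFin g
funToFin-cong {m = zero} _ = refl
funToFin-cong {m = suc m} f≗g = cong₂ combine (f≗g Fin.zero) (funToFin-cong (f≗g ∘ Fin.suc))

finToFun-injective : (t t' : Fin (n ^ m)) → finToFun {n} {m} t ≗ finToFun t' → t ≡ t'
finToFun-injective {n} {m} t t' e =
  trans (sym (funToFin-finToFin {m} {n} t)) (trans (funToFin-cong e) (funToFin-finToFin {m} {n} t'))

funToFin-injective : {f g : Fin m → Fin n} → funToFin f ≡ funToFin g → f ≗ g
funToFin-injective {f = f} {g} e t =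
  trans (sym (finToFun-funToFin f t)) (trans (cong (λ z → finToFun z t) e) (finToFun-funToFin g t))

n<2^n : ∀ m → m < 2 ^ m
n<2^n zero = s≤s z≤n
n<2^n (suc m) = begin-strict
  suc m         <⟨ s≤s (n<2^n m) ⟩
  suc (2 ^ m)   ≤⟨ +-monoˡ-≤ (2 ^ m) (m^n>0 2 m) ⟩
  2 ^ m + 2 ^ m ≡⟨ cong (2 ^ m +_) (sym (+-identityʳ (2 ^ m))) ⟩
  2 ^ suc m     ∎
  where open ≤-Reasoning

x+x+[x+x]≡2*[2*x] : ∀ x → x + x + (x + x) ≡ 2 * (2 * x)
x+x+[x+x]≡2*[2*x] = solve-∀

[2+4k]*k≡2k*[2k+1] : ∀ k → (2 + ((k + k) + (k + k))) * k ≡ (k + k) * suc (k + k)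
[2+4k]*k≡2k*[2k+1] = solve-∀

-- With I = 2^s and s = 4k: 2 + 2I ≤ 2^(s+2), and (s + 2) k = 2k (2k + 1) < 2^(2k) 2^(2k) = I.
exponential-beats-polynomial : ∀ k → ∃[ I ] suc (suc (I + I)) ^ k < 2 ^ I
exponential-beats-polynomial k = I , (begin-strict
  suc (suc (I + I)) ^ k ≤⟨ ^-monoˡ-≤ k 2+2I≤2^[2+s] ⟩
  (2 ^ (2 + s)) ^ k     ≡⟨ ^-*-assoc 2 (2 + s) k ⟩
  2 ^ ((2 + s) * k)     <⟨ ^-monoʳ-< 2 ≤-refl [2+s]k<I ⟩
  2 ^ I                 ∎)
  where
  open ≤-Reasoning
  h s I : ℕ
  h = k + k
  s = h + h
  I = 2 ^ s
  2+2I≤2^[2+s] : suc (suc (I + I)) ≤ 2 ^ (2 + s)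
  2+2I≤2^[2+s] = subst (suc (suc (I + I)) ≤_) (x+x+[x+x]≡2*[2*x] I)
                   (+-monoˡ-≤ (I + I) (+-mono-≤ (m^n>0 2 s) (m^n>0 2 s)))
  [2+s]k<I : (2 + s) * k < I
  [2+s]k<I = begin-strict
    (2 + s) * k       ≡⟨ [2+4k]*k≡2k*[2k+1] k ⟩
    h * suc h         <⟨ *-monoˡ-< (suc h) (n<1+n h) ⟩
    suc h * suc h     ≤⟨ *-mono-≤ (n<2^n h) (n<2^n h) ⟩
    2 ^ h * 2 ^ h     ≡⟨ sym (^-distribˡ-+-* 2 h h) ⟩
    I                 ∎

module _ {n k : ℕ} (c : V n → Fin k) (I : ℕ) where
  private
    word : Fin (n ^ I) → List (Fin n)
    word t = tabulate (finToFun {n} {I} t)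

    |word|≡I : ∀ t → length (word t) ≡ I
    |word|≡I t = length-tabulate (finToFun {n} {I} t)

    module Leaf (t : Fin (n ^ I)) = LeafCode c I (word t) (|word|≡I t)

  indistinguishable-leaves : suc (suc (I + I)) ^ k < n ^ I →
                             ∃[ u ] ∃[ v ] u ≢ v × SameCode n k c u v
  indistinguishable-leaves few-profiles with pigeonhole few-profiles (funToFin ∘ Leaf.profile)
  ... | t₁ , t₂ , t₁<t₂ , same =
    Leaf.leaf t₁ , Leaf.leaf t₂ , leaves-distinct ,
    sameCode-of-profile (word t₁) (|word|≡I t₁) (word t₂) (|word|≡I t₂) (funToFin-injective same)
    where
    leaves-distinct : Leaf.leaf t₁ ≢ Leaf.leaf t₂
    leaves-distinct e = <⇒≢ t₁<t₂
      (finToFun-injective t₁ t₂ (tabulate-injective {f = finToFun t₁} {finToFun t₂} (cong (proj₁ ∘ proj₂) e)))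

theorem6 : (n : ℕ) → 2 ≤ n → ChiLInfinite n
theorem6 n 2≤n k _ c (_ , codes-distinct) =
  let (I , few-profiles) = exponential-beats-polynomial k
      (u , v , u≢v , same-code) = indistinguishable-leaves c I (≤-trans few-profiles (^-monoˡ-≤ I 2≤n))
  in codes-distinct u v u≢v same-code
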